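{- If $T$ is a (finite) tree which has no perfect matching and no isolated vertex, then $T$ has at least two distinct maximum matchings.
   Context: A matching is a set of pairwise non-incident edges; a perfect matching covers all vertices; a maximum matching is a matching of largest possible size. -}

module Defs where

open import Data.Nat using (ℕ; zero; suc; _+_; _≤_)
open import Data.Fin using (Fin; zero; suc; toℕ; inject₁; fromℕ; _<?_)
open import Data.Bool using (Bool; true; false; if_then_else_; _∧_)
open import Data.List using (List; map; allFin)
open import Data.Nat.ListAction using (sum)
open import Data.Product using (Σ; ∃; _×_; ∃-syntax)
open import Relation.Binary.PropositionalEquality using (_≡_; _≢_)
open import Relation.Nullary using (¬_)
open import Relation.Nullary.Decidable using (⌊_⌋)
open import Function.Definitions using (Injective)

record Graph (n : ℕ) : Set where
  field
    Adj    : Fin n → Fin n → Bool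
    sym    : ∀ u v → Adj u v ≡ Adj v u
    irrefl : ∀ v → Adj v v ≡ false

open Graph public

Edge : ∀ {n} → Graph n → Fin n → Fin n → Set
Edge G u v = Adj G u v ≡ true

data Walk {n : ℕ} (G : Graph n) : Fin n → Fin n → Set where
  nil  : ∀ {u} → Walk G u u
  cons : ∀ {u v w} → Edge G u v → Walk G v w → Walk G u w

Connected : ∀ {n} → Graph n → Set
Connected G = ∀ u v → Walk G u v

record Cycle {n : ℕ} (G : Graph n) : Set where
  field
    k     : ℕ
    vtx   : Fin (suc (suc (suc k))) → Fin n
    inj   : Injective _≡_ _≡_ vtx
    step  : ∀ (i : Fin (suc (suc k))) → Edge G (vtx (inject₁ i)) (vtx (suc i))
    close : Edge G (vtx (fromℕ (suc (suc k)))) (vtx zero)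

Acyclic : ∀ {n} → Graph n → Set
Acyclic G = ¬ Cycle G

IsTree : ∀ {n} → Graph n → Set
IsTree G = Connected G × Acyclic G

record IsMatching {n : ℕ} (G : Graph n) (M : Fin n → Fin n → Bool) : Set where
  field
    sym      : ∀ u v → M u v ≡ M v u
    subgraph : ∀ u v → M u v ≡ true → Edge G u v
    disjoint : ∀ u v w → M u v ≡ true → M u w ≡ true → v ≡ w

-- Number of edges of M: number of pairs (u , v) with u < v and M u v.
size : ∀ {n} → (Fin n → Fin n → Bool) → ℕ
size {n} M =
  sum (map (λ u → sum (map (λ v → if ⌊ u <? v ⌋ ∧ M u v then 1 else 0) (allFin n))) (allFin n))

IsMaximumMatching : ∀ {n} → Graph n → (Fin n → Fin n → Bool) → Set
IsMaximumMatching {n} G M =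
  IsMatching G M × (∀ (M' : Fin n → Fin n → Bool) → IsMatching G M' → size M' ≤ size M)

IsPerfectMatching : ∀ {n} → Graph n → (Fin n → Fin n → Bool) → Set
IsPerfectMatching G M = IsMatching G M × (∀ v → ∃[ u ] M v u ≡ true)

HasPerfectMatching : ∀ {n} → Graph n → Set
HasPerfectMatching {n} G = ∃[ M ] IsPerfectMatching {n} G M

IsolatedVertex : ∀ {n} → Graph n → Fin n → Set
IsolatedVertex G v = ∀ u → Adj G v u ≡ false

HasIsolatedVertex : ∀ {n} → Graph n → Set
HasIsolatedVertex G = ∃[ v ] IsolatedVertex G v

-- Take a maximum matching M.  As there is no perfect matching, some vertex v is left
-- unmatched, and as v is not isolated it has a neighbour u.  Were u unmatched too, adding
-- the edge vu would enlarge M; so u is matched, say to w, and replacing uw by vu gives a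
-- second matching of the same size, hence maximum, which differs from M at vu.  The
-- argument never uses that T is a tree.
module Submission where

open import Defs
open import Data.Nat using (ℕ)
open import Data.Product using (∃; _×_; ∃-syntax)
open import Relation.Binary.PropositionalEquality using (_≢_)
open import Relation.Nullary using (¬_)

open import Data.Nat using (zero; suc; _+_; _*_; _≤_; z≤n; s≤s; _≤?_)
open import Data.Nat.Properties using (≤-refl; ≤-trans; ≤-reflexive; ≤-pred; ≤∧≢⇒<; +-mono-≤; +-suc; *-identityʳ; 1+n≰n)
open import Data.Nat.ListAction using (sum)
open import Data.Fin using (Fin; zero; suc; _<?_; combine; remQuot) renaming (_<_ to _<ᶠ_)
open import Data.Fin.Properties using (_≟_; all?; any?; ¬∀⟶∃¬; <-cmp; <-asym; <⇒≢; suc-injective; remQuot-combine)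
open import Data.Fin.Subset using (Subset)
open import Data.Fin.Subset.Properties using (anySubset?)
open import Data.Bool using (Bool; true; false; if_then_else_; _∧_)
open import Data.Bool.Properties using (¬-not) renaming (_≟_ to _≟ᵇ_)
open import Data.List using (map; tabulate; allFin)
open import Data.List.Properties using (tabulate-cong; map-tabulate)
import Data.Vec as Vec
open import Data.Vec.Properties using (lookup∘tabulate)
open import Data.Product using (_,_; proj₁; proj₂; uncurry)
open import Data.Sum using (_⊎_; inj₁; inj₂; [_,_]′)
import Data.Sum as Sum
open import Function using (_∘_; id)
open import Relation.Nullary using (Dec; yes; no; does; contradiction)
open import Relation.Nullary.Decidable using (⌊_⌋; map′; _×-dec_; _⊎-dec_; _→-dec_; dec-true; dec-false)
open import Relation.Unary using (Decidable)
open import Relation.Binary.PropositionalEquality using (_≡_; refl; trans; cong; cong₂; module ≡-Reasoning)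
import Relation.Binary.PropositionalEquality as ≡
open import Relation.Binary.Definitions using (tri<; tri≈; tri>)

greatest-witness : ∀ {p} {P : ℕ → Set p} → Decidable P → ∀ B → (∀ k → P k → k ≤ B) → P 0 →
                   ∃ λ k → P k × (∀ j → P j → j ≤ k)
greatest-witness P? zero    bounded p₀ = 0 , p₀ , bounded
greatest-witness P? (suc B) bounded p₀ with P? (suc B)
... | yes p = suc B , p , bounded
... | no ¬p = greatest-witness P? B (λ j pj → ≤-pred (≤∧≢⇒< (bounded j pj) λ { refl → ¬p pj })) p₀

sum-tabulate-≤ : ∀ {n} (f : Fin n → ℕ) {c} → (∀ i → f i ≤ c) → sum (tabulate f) ≤ n * c
sum-tabulate-≤ {zero}  f bounded = z≤n
sum-tabulate-≤ {suc n} f bounded = +-mono-≤ (bounded zero) (sum-tabulate-≤ (f ∘ suc) (bounded ∘ suc))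

sum-tabulate-suc : ∀ {n} (f g : Fin n → ℕ) (a : Fin n) → f a ≡ suc (g a) → (∀ i → i ≢ a → f i ≡ g i) →
                   sum (tabulate f) ≡ suc (sum (tabulate g))
sum-tabulate-suc f g zero fa≡1+ga f≡g =
  cong₂ _+_ fa≡1+ga (cong sum (tabulate-cong λ i → f≡g (suc i) λ ()))
sum-tabulate-suc f g (suc a) fa≡1+ga f≡g = trans
  (cong₂ _+_ (f≡g zero λ ()) (sum-tabulate-suc (f ∘ suc) (g ∘ suc) a fa≡1+ga λ i i≢a → f≡g (suc i) (i≢a ∘ suc-injective)))
  (+-suc (g zero) _)

EdgeSet : ℕ → Set
EdgeSet n = Fin n → Fin n → Bool

module _ {n : ℕ} where

  Symmetric : EdgeSet n → Set
  Symmetric M = ∀ x y → M x y ≡ M y x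

  _≐_ : EdgeSet n → EdgeSet n → Set
  M ≐ M' = ∀ x y → M x y ≡ M' x y

  pairCount : EdgeSet n → Fin n → Fin n → ℕ
  pairCount M u v = if ⌊ u <? v ⌋ ∧ M u v then 1 else 0

  pairCount≤1 : ∀ M u v → pairCount M u v ≤ 1
  pairCount≤1 M u v with ⌊ u <? v ⌋ ∧ M u v
  ... | true  = s≤s z≤n
  ... | false = z≤n

  pairCount-< : ∀ M {u v} → u <ᶠ v → pairCount M u v ≡ (if M u v then 1 else 0)
  pairCount-< M {u} {v} u<v with u <? v
  ... | yes _   = refl
  ... | no u≮v = contradiction u<v u≮v

  pairCount-≮ : ∀ M {u v} → ¬ u <ᶠ v → pairCount M u v ≡ 0
  pairCount-≮ M {u} {v} u≮v with u <? v
  ... | yes u<v = contradiction u<v u≮v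
  ... | no _    = refl

  rowCount : EdgeSet n → Fin n → ℕ
  rowCount M u = sum (tabulate (pairCount M u))

  size-tabulate : ∀ M → size M ≡ sum (tabulate (rowCount M))
  size-tabulate M = cong sum (trans (map-tabulate id λ u → sum (map (pairCount M u) (allFin n)))
                                    (tabulate-cong λ u → cong sum (map-tabulate id (pairCount M u))))

  size-cong : ∀ {M M'} → M ≐ M' → size M ≡ size M'
  size-cong {M} {M'} M≐M' = begin
    size M                       ≡⟨ size-tabulate M ⟩
    sum (tabulate (rowCount M))  ≡⟨ cong sum (tabulate-cong λ u → cong sum (tabulate-cong λ v →
                                      cong (λ b → if ⌊ u <? v ⌋ ∧ b then 1 else 0) (M≐M' u v))) ⟩
    sum (tabulate (rowCount M')) ≡⟨ ≡.sym (size-tabulate M') ⟩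
    size M'                      ∎
    where open ≡-Reasoning

  size≤n² : ∀ M → size M ≤ n * n
  size≤n² M = ≤-trans (≤-reflexive (size-tabulate M))
    (sum-tabulate-≤ _ λ u → ≤-trans (sum-tabulate-≤ _ (pairCount≤1 M u)) (≤-reflexive (*-identityʳ n)))

  SamePair : Fin n → Fin n → Fin n → Fin n → Set
  SamePair p q x y = (x ≡ p × y ≡ q) ⊎ (x ≡ q × y ≡ p)

  samePair? : ∀ p q x y → Dec (SamePair p q x y)
  samePair? p q x y = (x ≟ p ×-dec y ≟ q) ⊎-dec (x ≟ q ×-dec y ≟ p)

  SamePair-flip : ∀ {p q x y} → SamePair p q x y → SamePair p q y x
  SamePair-flip (inj₁ (x≡p , y≡q)) = inj₂ (y≡q , x≡p)
  SamePair-flip (inj₂ (x≡q , y≡p)) = inj₁ (y≡p , x≡q)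

  SamePair-partner : ∀ {p q x y z} → p ≢ q → SamePair p q x y → SamePair p q x z → y ≡ z
  SamePair-partner p≢q (inj₁ (_ , y≡q)) (inj₁ (_ , z≡q)) = trans y≡q (≡.sym z≡q)
  SamePair-partner p≢q (inj₂ (_ , y≡p)) (inj₂ (_ , z≡p)) = trans y≡p (≡.sym z≡p)
  SamePair-partner p≢q (inj₁ (x≡p , _)) (inj₂ (x≡q , _)) = contradiction (trans (≡.sym x≡p) x≡q) p≢q
  SamePair-partner p≢q (inj₂ (x≡q , _)) (inj₁ (x≡p , _)) = contradiction (trans (≡.sym x≡p) x≡q) p≢q

  -- Opaque so that unification treats update M p q b x y as rigid; it is only ever
  -- reasoned about through update-inside and update-outside.
  opaque
    update : EdgeSet n → Fin n → Fin n → Bool → EdgeSet n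
    update M p q b x y = if does (samePair? p q x y) then b else M x y

    update-inside : ∀ {M p q b x y} → SamePair p q x y → update M p q b x y ≡ b
    update-inside {p = p} {q} {x = x} {y} s rewrite dec-true (samePair? p q x y) s = refl

    update-outside : ∀ {M p q b x y} → ¬ SamePair p q x y → update M p q b x y ≡ M x y
    update-outside {p = p} {q} {x = x} {y} ¬s rewrite dec-false (samePair? p q x y) ¬s = refl

  update-symmetric : ∀ {M} → Symmetric M → ∀ p q b → Symmetric (update M p q b)
  update-symmetric M-sym p q b x y with samePair? p q x y
  ... | yes s  = trans (update-inside s) (≡.sym (update-inside (SamePair-flip s)))
  ... | no ¬s  = trans (update-outside ¬s) (trans (M-sym x y) (≡.sym (update-outside (¬s ∘ SamePair-flip))))

  size-insert< : ∀ {M M' a b} → a <ᶠ b → M a b ≡ false → M' a b ≡ true →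
                 (∀ x y → ¬ SamePair a b x y → M' x y ≡ M x y) → size M' ≡ suc (size M)
  size-insert< {M} {M'} {a} {b} a<b Mab M'ab agree = begin
    size M'                            ≡⟨ size-tabulate M' ⟩
    sum (tabulate (rowCount M'))       ≡⟨ sum-tabulate-suc _ _ a row-a other-row ⟩
    suc (sum (tabulate (rowCount M)))  ≡⟨ cong suc (≡.sym (size-tabulate M)) ⟩
    suc (size M)                       ∎
    where
    open ≡-Reasoning
    agree-count : ∀ x y → ¬ SamePair a b x y → pairCount M' x y ≡ pairCount M x y
    agree-count x y ¬s = cong (λ c → if ⌊ x <? y ⌋ ∧ c then 1 else 0) (agree x y ¬s)
    entry-ab : pairCount M' a b ≡ suc (pairCount M a b)
    entry-ab rewrite pairCount-< M' a<b | pairCount-< M a<b | Mab | M'ab = refl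
    row-a : rowCount M' a ≡ suc (rowCount M a)
    row-a = sum-tabulate-suc _ _ b entry-ab λ v v≢b → agree-count a v
      λ { (inj₁ (_ , v≡b)) → v≢b v≡b ; (inj₂ (a≡b , _)) → <⇒≢ a<b a≡b }
    other-entry : ∀ {u} → u ≢ a → ∀ v → pairCount M' u v ≡ pairCount M u v
    other-entry {u} u≢a v with samePair? a b u v
    ... | no ¬s                   = agree-count u v ¬s
    ... | yes (inj₁ (u≡a , _))    = contradiction u≡a u≢a
    ... | yes (inj₂ (refl , refl)) =
      trans (pairCount-≮ M' (<-asym a<b)) (≡.sym (pairCount-≮ M (<-asym a<b)))
    other-row : ∀ u → u ≢ a → rowCount M' u ≡ rowCount M u
    other-row u u≢a = cong sum (tabulate-cong (other-entry u≢a))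

  size-insert : ∀ {M p q} → Symmetric M → p ≢ q → M p q ≡ false → size (update M p q true) ≡ suc (size M)
  size-insert {M} {p} {q} M-sym p≢q Mpq with <-cmp p q
  ... | tri< p<q _ _ = size-insert< p<q Mpq (update-inside (inj₁ (refl , refl))) λ x y → update-outside
  ... | tri≈ _ p≡q _ = contradiction p≡q p≢q
  ... | tri> _ _ q<p = size-insert< q<p (trans (M-sym q p) Mpq) (update-inside (inj₂ (refl , refl)))
                         λ x y ¬s → update-outside (¬s ∘ Sum.swap)

  size-delete : ∀ {M p q} → Symmetric M → p ≢ q → M p q ≡ true → size M ≡ suc (size (update M p q false))
  size-delete {M} {p} {q} M-sym p≢q Mpq = begin
    size M                    ≡⟨ size-cong reinsert ⟩
    size (update M₀ p q true) ≡⟨ size-insert (update-symmetric M-sym p q false) p≢q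
                                             (update-inside (inj₁ (refl , refl))) ⟩
    suc (size M₀)             ∎
    where
    open ≡-Reasoning
    M₀ : EdgeSet n
    M₀ = update M p q false
    reinsert : M ≐ update M₀ p q true
    reinsert x y with samePair? p q x y
    ... | yes s@(inj₁ (refl , refl)) = trans Mpq (≡.sym (update-inside s))
    ... | yes s@(inj₂ (refl , refl)) = trans (trans (M-sym q p) Mpq) (≡.sym (update-inside s))
    ... | no ¬s                      = ≡.sym (trans (update-outside ¬s) (update-outside ¬s))

  delete-⊆ : ∀ {M : EdgeSet n} p q x y → update M p q false x y ≡ true → M x y ≡ true
  delete-⊆ p q x y with samePair? p q x y
  ... | yes s  = λ h → contradiction (trans (≡.sym (update-inside s)) h) λ ()
  ... | no ¬s  = trans (≡.sym (update-outside ¬s))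

  insert-inv : ∀ {M : EdgeSet n} p q x y → update M p q true x y ≡ true → SamePair p q x y ⊎ M x y ≡ true
  insert-inv p q x y h with samePair? p q x y
  ... | yes s  = inj₁ s
  ... | no ¬s  = inj₂ (trans (≡.sym (update-outside ¬s)) h)

  -- Searching Subset (n * n) through the index pairing combine; the search only reaches
  -- each edge set up to ≐ (there is no function extensionality), hence the hypothesis resp.
  any-edgeSet? : ∀ {p} (P : EdgeSet n → Set p) → (∀ {M M'} → M ≐ M' → P M → P M') →
                 (∀ M → Dec (P M)) → Dec (∃ P)
  any-edgeSet? P resp P? = map′ (λ (S , p) → toEdgeSet S , p)
                                (λ (M , p) → fromEdgeSet M , resp (λ x y → ≡.sym (roundtrip M x y)) p)
                                (anySubset? (P? ∘ toEdgeSet))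
    where
    toEdgeSet : Subset (n * n) → EdgeSet n
    toEdgeSet S x y = Vec.lookup S (combine x y)
    fromEdgeSet : EdgeSet n → Subset (n * n)
    fromEdgeSet M = Vec.tabulate (uncurry M ∘ remQuot n)
    roundtrip : ∀ M → toEdgeSet (fromEdgeSet M) ≐ M
    roundtrip M x y = trans (lookup∘tabulate _ (combine x y)) (cong (uncurry M) (remQuot-combine x y))

  Matched : EdgeSet n → Fin n → Set
  Matched M v = ∃ λ u → M v u ≡ true

  matched? : ∀ M v → Dec (Matched M v)
  matched? M v = any? λ u → M v u ≟ᵇ true

module _ {n : ℕ} (G : Graph n) where

  edge-distinct : ∀ {p q} → Edge G p q → p ≢ q
  edge-distinct {p} pq refl = contradiction (trans (≡.sym pq) (irrefl G p)) λ ()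

  SamePair-edge : ∀ {p q x y} → Edge G p q → SamePair p q x y → Edge G x y
  SamePair-edge pq (inj₁ (refl , refl)) = pq
  SamePair-edge pq (inj₂ (refl , refl)) = trans (Graph.sym G _ _) pq

  isMatching? : ∀ M → Dec (IsMatching G M)
  isMatching? M = map′
    (λ (M-sym , M⊆G , M-disj) → record { sym = M-sym ; subgraph = M⊆G ; disjoint = M-disj })
    (λ m → IsMatching.sym m , IsMatching.subgraph m , IsMatching.disjoint m)
    (all? (λ x → all? λ y → M x y ≟ᵇ M y x) ×-dec
     all? (λ x → all? λ y → (M x y ≟ᵇ true) →-dec (Adj G x y ≟ᵇ true)) ×-dec
     all? (λ x → all? λ y → all? λ z → (M x y ≟ᵇ true) →-dec ((M x z ≟ᵇ true) →-dec (y ≟ z))))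

  empty-isMatching : IsMatching G (λ _ _ → false)
  empty-isMatching = record { sym = λ _ _ → refl ; subgraph = λ _ _ () ; disjoint = λ _ _ _ () }

  isMatching-⊆ : ∀ {M M'} → IsMatching G M → Symmetric M' → (∀ x y → M' x y ≡ true → M x y ≡ true) →
                 IsMatching G M'
  isMatching-⊆ m M'-sym M'⊆M = record
    { sym      = M'-sym
    ; subgraph = λ x y h → IsMatching.subgraph m x y (M'⊆M x y h)
    ; disjoint = λ x y z h h' → IsMatching.disjoint m x y z (M'⊆M x y h) (M'⊆M x z h')
    }

  isMatching-cong : ∀ {M M'} → M ≐ M' → IsMatching G M → IsMatching G M'
  isMatching-cong {M} {M'} M≐M' m = isMatching-⊆ m
    (λ x y → trans (≡.sym (M≐M' x y)) (trans (IsMatching.sym m x y) (M≐M' y x)))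
    (λ x y → trans (M≐M' x y))

  delete-isMatching : ∀ {M} p q → IsMatching G M → IsMatching G (update M p q false)
  delete-isMatching p q m = isMatching-⊆ m (update-symmetric (IsMatching.sym m) p q false) (delete-⊆ p q)

  insert-isMatching : ∀ {M p q} → IsMatching G M → Edge G p q → ¬ Matched M p → ¬ Matched M q →
                      IsMatching G (update M p q true)
  insert-isMatching {M} {p} {q} m pq p-free q-free = record
    { sym      = update-symmetric (IsMatching.sym m) p q true
    ; subgraph = λ x y h → [ SamePair-edge pq , IsMatching.subgraph m x y ]′ (insert-inv p q x y h)
    ; disjoint = λ x y z h h' → partner (insert-inv p q x y h) (insert-inv p q x z h')
    }
    where
    endpoint-free : ∀ {x y} → SamePair p q x y → ¬ Matched M x
    endpoint-free (inj₁ (refl , _)) = p-free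
    endpoint-free (inj₂ (refl , _)) = q-free
    partner : ∀ {x y z} → SamePair p q x y ⊎ M x y ≡ true → SamePair p q x z ⊎ M x z ≡ true → y ≡ z
    partner (inj₁ s) (inj₁ t)  = SamePair-partner (edge-distinct pq) s t
    partner (inj₁ s) (inj₂ h)  = contradiction (_ , h) (endpoint-free s)
    partner (inj₂ h) (inj₁ t)  = contradiction (_ , h) (endpoint-free t)
    partner (inj₂ h) (inj₂ h') = IsMatching.disjoint m _ _ _ h h'

  matching-of-size≥? : ∀ k → Dec (∃ λ M → IsMatching G M × k ≤ size M)
  matching-of-size≥? k = any-edgeSet? _
    (λ M≐M' (m , k≤M) → isMatching-cong M≐M' m , ≤-trans k≤M (≤-reflexive (size-cong M≐M')))
    (λ M → isMatching? M ×-dec k ≤? size M)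

  maximumMatching : ∃ (IsMaximumMatching G)
  maximumMatching
    with k , (M , m , k≤M) , greatest ← greatest-witness matching-of-size≥? (n * n)
                                          (λ k (M , _ , k≤M) → ≤-trans k≤M (size≤n² M))
                                          (_ , empty-isMatching , z≤n)
    = M , m , λ M' m' → ≤-trans (greatest (size M') (M' , m' , ≤-refl)) k≤M

  neighbour : ∀ {v} → ¬ IsolatedVertex G v → ∃ (Edge G v)
  neighbour {v} not-isolated
    with u , ¬vu ← ¬∀⟶∃¬ n _ (λ u → Adj G v u ≟ᵇ false) not-isolated = u , ¬-not ¬vu

  unmatched-vertex : ∀ {M} → ¬ (∀ v → Matched M v) → ∃ λ v → ¬ Matched M v
  unmatched-vertex {M} = ¬∀⟶∃¬ n _ (matched? M)

  module _ {M : EdgeSet n} (M-max : IsMaximumMatching G M) where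

    private
      m : IsMatching G M
      m = proj₁ M-max

    free-neighbour-matched : ∀ {v u} → ¬ Matched M v → Edge G v u → Matched M u
    free-neighbour-matched {v} {u} v-free vu with matched? M u
    ... | yes u-matched = u-matched
    ... | no u-free     = contradiction (≤-trans (≤-reflexive (≡.sym enlarged)) (proj₂ M-max _ m')) 1+n≰n
      where
      m' : IsMatching G (update M v u true)
      m' = insert-isMatching m vu v-free u-free
      enlarged : size (update M v u true) ≡ suc (size M)
      enlarged = size-insert (IsMatching.sym m) (edge-distinct vu) (¬-not λ h → v-free (u , h))

    exchange-isMaximum : ∀ {v u w} → ¬ Matched M v → Edge G v u → M u w ≡ true →
                         IsMaximumMatching G (update (update M u w false) v u true)
    exchange-isMaximum {v} {u} {w} v-free vu uw =
      m' , λ M'' m'' → ≤-trans (proj₂ M-max M'' m'') (≤-reflexive same-size)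
      where
      M₀ : EdgeSet n
      M₀ = update M u w false
      v-free₀ : ¬ Matched M₀ v
      v-free₀ (z , h) = v-free (z , delete-⊆ u w v z h)
      u-free₀ : ¬ Matched M₀ u
      u-free₀ (z , h) with refl ← IsMatching.disjoint m u z w (delete-⊆ u w u z h) uw =
        contradiction (trans (≡.sym (update-inside (inj₁ (refl , refl)))) h) λ ()
      m' : IsMatching G (update M₀ v u true)
      m' = insert-isMatching (delete-isMatching u w m) vu v-free₀ u-free₀
      same-size : size M ≡ size (update M₀ v u true)
      same-size = trans (size-delete (IsMatching.sym m) (edge-distinct (IsMatching.subgraph m u w uw)) uw)
                        (≡.sym (size-insert (update-symmetric (IsMatching.sym m) u w false) (edge-distinct vu)
                                            (¬-not λ h → v-free₀ (u , h))))

lemma5 : ∀ (n : ℕ) (T : Graph n) → IsTree T → ¬ HasPerfectMatching T → ¬ HasIsolatedVertex T →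
    ∃[ M₁ ] ∃[ M₂ ] (IsMaximumMatching T M₁ × IsMaximumMatching T M₂ ×
    ∃[ u ] ∃[ v ] M₁ u v ≢ M₂ u v)
lemma5 n T _ no-perfect no-isolated =
  let M , M-max = maximumMatching T
      v , v-free = unmatched-vertex T λ all-matched → no-perfect (M , proj₁ M-max , all-matched)
      u , vu = neighbour T λ isolated → no-isolated (v , isolated)
      w , uw = free-neighbour-matched T M-max v-free vu
  in  M , _ , M-max , exchange-isMaximum T M-max v-free vu uw ,
      v , u , λ Mvu≡M'vu → v-free (u , trans Mvu≡M'vu (update-inside (inj₁ (refl , refl))))
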